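{- Let $H$ be an $r$-partite $r$-graph with partition classes $V_1,V_2,\dots,V_r$, where $|V_i|=m$ for all $i\in[r]$. Suppose $H(V_1,V_2,\dots,V_r)$ is $(\varepsilon,d)$-regular. Then there are at most $\frac{3r}{(d-\varepsilon)\varepsilon}$ vertex-disjoint tight paths in $H$ that cover all but at most $r\varepsilon m$ vertices of $H$.
   Context: An $r$-partite $r$-graph $H(X_1,\dots,X_r)$ has vertex set partitioned into $X_1,\dots,X_r$ and every edge meets each $X_i$ in exactly one vertex. For $A_i\subseteq X_i$, $e(A_1,\dots,A_r)$ is the number of edges with one vertex in each $A_i$ and $d(A_1,\dots,A_r)=\frac{e(A_1,\dots,A_r)}{|A_1|\cdots|A_r|}$. $H(X_1,\dots,X_r)$ is $(\varepsilon,d)$-regular, where $d=d(X_1,\dots,X_r)$, if for all $A_i\subseteq X_i$ with $|A_i|\geq\varepsilon|X_i|$ for all $i\in[r]$, one has $|d(A_1,\dots,A_r)-d(X_1,\dots,X_r)|\leq\varepsilon$. A tight path is an $r$-graph whose vertices can be ordered $v_1,\dots,v_m$ so that its edges are exactly $\{v_i,\dots,v_{i+r-1}\}$ for $i=1,\dots,m-r+1$.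
   Formalization: The regularity parameter ε takes rational values. -}

module Defs where

open import Data.Bool using (Bool; true; false; _∧_; if_then_else_)
open import Data.Nat as ℕ using (ℕ; zero; suc; _≤ᵇ_)
open import Data.Integer using (+_)
open import Data.Fin using (Fin)
open import Data.Fin.Subset using (Subset)
open import Data.Vec using (Vec; []; _∷_; lookup)
open import Data.List using (List; []; _∷_; map; concatMap; filterᵇ; length; take; allFin; foldr)
open import Data.Product using (_×_; _,_; Σ)
open import Data.Rational using (ℚ; _/_; 0ℚ)
open import Relation.Binary.PropositionalEquality using (_≡_)
open import Data.List.Membership.Propositional using (_∈_)

-- An r-partite r-graph with classes V_1..V_r, each of size m.
-- Vertex (i , j) is the j-th vertex of class V_i.
Vertex : ℕ → ℕ → Set
Vertex r m = Fin r × Fin m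

-- A potential edge picks one vertex e_i ∈ V_i from each class.
Crossing : ℕ → ℕ → Set
Crossing r m = Vec (Fin m) r

RGraph : ℕ → ℕ → Set
RGraph r m = Crossing r m → Bool

allCrossing : (r m : ℕ) → List (Crossing r m)
allCrossing zero m = [] ∷ []
allCrossing (suc r) m = concatMap (λ x → map (x ∷_) (allCrossing r m)) (allFin m)

inAll : {r m : ℕ} → (Fin r → Subset m) → Crossing r m → Bool
inAll {r} A e = foldr _∧_ true (map (λ i → lookup (A i) (lookup e i)) (allFin r))

edgesBetween : {r m : ℕ} → RGraph r m → (Fin r → Subset m) → ℕ
edgesBetween {r} {m} H A = length (filterᵇ (λ e → H e ∧ inAll A e) (allCrossing r m))

prodSizes : {r m : ℕ} → (Fin r → Subset m) → ℕ
prodSizes {r} A = foldr ℕ._*_ 1 (map (λ i → Data.Fin.Subset.∣ A i ∣) (allFin r))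

-- e / n as a rational (0 when n = 0; never used in that case)
ratio : ℕ → ℕ → ℚ
ratio e zero = 0ℚ
ratio e (suc n) = (+ e) / suc n

density : {r m : ℕ} → RGraph r m → (Fin r → Subset m) → ℚ
density H A = ratio (edgesBetween H A) (prodSizes A)

full : {r m : ℕ} → Fin r → Subset m
full _ = Data.Fin.Subset.⊤

fromℕℚ : ℕ → ℚ
fromℕℚ n = (+ n) / 1

IsRegular : {r m : ℕ} → ℚ → RGraph r m → Set
IsRegular {r} {m} ε H =
  (A : Fin r → Subset m) →
  (∀ i → ε Data.Rational.* fromℕℚ m Data.Rational.≤ fromℕℚ Data.Fin.Subset.∣ A i ∣) →
  Data.Rational.∣ density H A Data.Rational.- density H full ∣ Data.Rational.≤ ε

windows : {A : Set} → ℕ → List A → List (List A)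
windows k [] = if k ≤ᵇ 0 then [] ∷ [] else []
windows k (x ∷ xs) = if k ≤ᵇ suc (length xs) then take k (x ∷ xs) ∷ windows k xs else []

IsEdgeOf : {r m : ℕ} → RGraph r m → List (Vertex r m) → Set
IsEdgeOf {r} H ws =
  Σ (Crossing r _) λ e → (H e ≡ true) × (length ws ≡ r) × (∀ i → (i , lookup e i) ∈ ws)

-- vertex sequence v_1..v_k (k ≥ 1) all of whose r-windows are edges of H:
-- a tight path in H (distinctness of vertices is imposed on the whole family)
data NonEmpty {A : Set} : List A → Set where
  nonEmpty : ∀ {x xs} → NonEmpty (x ∷ xs)

IsTightPathIn : {r m : ℕ} → RGraph r m → List (Vertex r m) → Set
IsTightPathIn {r} H p =
  NonEmpty p × (∀ w → w ∈ windows r p → IsEdgeOf H w)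

module Submission where

-- While every class still has u ≥ εm unused vertices U_i, regularity gives the
-- box U_1 × ⋯ × U_r density at least d − ε. Pick t with t·r·u^r < u·e(U) ≤ (t+1)·r·u^r and keep
-- deleting light fibres (sets of ≤ t edges that agree off one coordinate); the inequality
-- t·#(live fibre crossings) < u·#edges survives each deletion, so a nonempty subgraph remains in
-- which every live fibre has more than t edges. There a tight path of t+1 blocks is grown greedily,
-- replacing one coordinate at a time by a vertex not yet used: a live fibre has more than t edges,
-- while the path so far occupies at most t vertices of each class. Each path uses t+1 vertices per
-- class and (t+1)·r ≥ (d−ε)·ε·m, so at most r/((d−ε)ε) paths are built before some class has
-- fewer than εm unused vertices left.

open import Defs
open import Data.Nat using (ℕ; zero; suc)
open import Data.Rational as ℚ using (ℚ; 0ℚ)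

module TightPaths where

  open import Data.Bool using (Bool; true; false; _∧_; not; if_then_else_)
  open import Data.Bool.Properties using (∧-zeroʳ; ∧-identityʳ; T-≡) renaming (_≟_ to _≟ᵇ_)
  open import Data.Nat as ℕ using (ℕ; zero; suc; _+_; _*_; _∸_; _^_; _≤_; _<_; _<ᵇ_; _≤ᵇ_; z≤n; s≤s; s≤s⁻¹)
  open import Data.Nat.Properties
  open import Data.Nat.DivMod using (_/_; _%_; m/n*n≤m; m≡m%n+[m/n]*n; m%n<n)
  open import Data.Fin as F using (Fin; toℕ)
  import Data.Fin.Properties as Fin
  open import Data.Fin.Subset using (Subset; ∣_∣; ⁅_⁆; _─_)
  open import Data.Fin.Subset.Properties using (x∈⁅x⁆; x∈⁅y⁆⇒x≡y; ∣⁅x⁆∣≡1)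
  open import Data.Vec using ([]; _∷_; lookup)
  open import Data.Vec.Properties using ([]=⇒lookup; lookup⇒[]=)
  open import Data.Vec.Functional using (updateAt)
  open import Data.Vec.Functional.Properties using (updateAt-updates; updateAt-minimal)
  open import Data.List as L using (List; []; _∷_; map; concatMap; filterᵇ; length; allFin; foldr; _++_; take; drop)
  open import Data.Nat.ListAction using (sum)
  open import Data.List.Properties
    using (map-tabulate; length-++; filter-++; length-tabulate; length-map; length-take; length-drop;
           take-map; drop-map; ++-identityʳ; ++-assoc)
  open import Data.List.Membership.Propositional using (_∈_; lose)
  open import Data.List.Membership.Propositional.Properties using (∈-allFin; ∈-map⁺; ∈-map⁻; ∈-concatMap⁺; ∈-++⁻)
  open import Data.List.Relation.Unary.Any using (here; there; any?; satisfied)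
  open import Data.Product using (_×_; _,_; Σ; proj₁; proj₂; uncurry)
  open import Data.List.Relation.Unary.Unique.Propositional using (Unique)
  open import Data.List.Relation.Unary.Unique.Propositional.Properties using (++⁺; map⁺; allFin⁺)
  open import Function using (_∘_)
  open import Relation.Binary.PropositionalEquality
  open import Relation.Nullary using (¬_; yes; no; contradiction; Dec; _×-dec_)
  open import Data.Sum using (_⊎_; inj₁; inj₂)
  open import Function.Bundles using (Equivalence)

  -- Counting and finite subsets

  ∧≡true⁻ : {a b : Bool} → a ∧ b ≡ true → a ≡ true × b ≡ true
  ∧≡true⁻ {true} {true} _ = refl , refl

  ∧≡true⁺ : {a b : Bool} → a ≡ true → b ≡ true → a ∧ b ≡ true
  ∧≡true⁺ refl refl = refl

  countᵇ : {A : Set} → (A → Bool) → List A → ℕ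
  countᵇ p xs = length (filterᵇ p xs)

  module _ {A : Set} where

    countᵇ-mono : (p q : A → Bool) (xs : List A) → (∀ x → p x ≡ true → q x ≡ true) →
      countᵇ p xs ≤ countᵇ q xs
    countᵇ-mono p q [] h = z≤n
    countᵇ-mono p q (x ∷ xs) h with p x in px | q x in qx
    ... | true  | true  = s≤s (countᵇ-mono p q xs h)
    ... | true  | false with () ← trans (sym (h x px)) qx
    ... | false | true  = m≤n⇒m≤1+n (countᵇ-mono p q xs h)
    ... | false | false = countᵇ-mono p q xs h

    countᵇ-cong : (p q : A → Bool) (xs : List A) → (∀ x → p x ≡ q x) → countᵇ p xs ≡ countᵇ q xs
    countᵇ-cong p q [] h = refl
    countᵇ-cong p q (x ∷ xs) h rewrite h x with q x
    ... | true  = cong suc (countᵇ-cong p q xs h)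
    ... | false = countᵇ-cong p q xs h

    countᵇ-split : (p q : A → Bool) (xs : List A) →
      countᵇ p xs ≡ countᵇ (λ x → p x ∧ q x) xs + countᵇ (λ x → p x ∧ not (q x)) xs
    countᵇ-split p q [] = refl
    countᵇ-split p q (x ∷ xs) with p x | q x
    ... | true  | true  = cong suc (countᵇ-split p q xs)
    ... | true  | false = trans (cong suc (countᵇ-split p q xs)) (sym (+-suc _ _))
    ... | false | _     = countᵇ-split p q xs

    countᵇ-none : (p : A → Bool) (xs : List A) → (∀ x → p x ≡ false) → countᵇ p xs ≡ 0
    countᵇ-none p [] h = refl
    countᵇ-none p (x ∷ xs) h rewrite h x = countᵇ-none p xs h

    countᵇ-const-∧ : (b : Bool) (p : A → Bool) (xs : List A) →
      countᵇ (λ x → b ∧ p x) xs ≡ (if b then countᵇ p xs else 0)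
    countᵇ-const-∧ true  p xs = refl
    countᵇ-const-∧ false p xs = countᵇ-none _ xs (λ _ → refl)

    countᵇ-++ : (p : A → Bool) (xs ys : List A) → countᵇ p (xs ++ ys) ≡ countᵇ p xs + countᵇ p ys
    countᵇ-++ p xs ys = trans (cong length (filter-++ _ xs ys)) (length-++ (filterᵇ p xs))

    countᵇ-pos : (p : A → Bool) {x : A} (xs : List A) → x ∈ xs → p x ≡ true → 0 < countᵇ p xs
    countᵇ-pos p (y ∷ xs) (here refl) px rewrite px = s≤s z≤n
    countᵇ-pos p (y ∷ xs) (there x∈xs) px with p y
    ... | true  = s≤s z≤n
    ... | false = countᵇ-pos p xs x∈xs px

    private
      skip : {P : A → Set} {x : A} {xs : List A} →
        Σ A (λ y → y ∈ xs × P y) → Σ A (λ y → y ∈ x ∷ xs × P y)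
      skip (y , y∈xs , py) = y , there y∈xs , py

    countᵇ-<⇒∃ : (p q : A → Bool) (xs : List A) → countᵇ q xs < countᵇ p xs →
      Σ A λ x → x ∈ xs × p x ≡ true × q x ≡ false
    countᵇ-<⇒∃ p q (x ∷ xs) h with p x in px | q x in qx
    ... | true  | false = x , here refl , px , qx
    ... | true  | true  = skip (countᵇ-<⇒∃ p q xs (s≤s⁻¹ h))
    ... | false | true  = skip (countᵇ-<⇒∃ p q xs (<-trans (n<1+n _) h))
    ... | false | false = skip (countᵇ-<⇒∃ p q xs h)

  module _ {A B : Set} where

    countᵇ-map : (p : B → Bool) (f : A → B) (xs : List A) → countᵇ p (map f xs) ≡ countᵇ (p ∘ f) xs
    countᵇ-map p f [] = refl
    countᵇ-map p f (x ∷ xs) with p (f x)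
    ... | true  = cong suc (countᵇ-map p f xs)
    ... | false = countᵇ-map p f xs

  countᵇ>0⇒∃ : {A : Set} (p : A → Bool) (xs : List A) → 0 < countᵇ p xs → Σ A λ x → x ∈ xs × p x ≡ true
  countᵇ>0⇒∃ p xs h with countᵇ-<⇒∃ p (λ _ → false) xs (subst (_< countᵇ p xs) (sym (countᵇ-none _ xs (λ _ → refl))) h)
  ... | x , x∈xs , px , _ = x , x∈xs , px

  countᵇ-tabulate-suc : {n : ℕ} (p : Fin (suc n) → Bool) →
    countᵇ p (L.tabulate {n = n} F.suc) ≡ countᵇ (p ∘ F.suc) (allFin n)
  countᵇ-tabulate-suc {n} p =
    trans (cong (countᵇ p) (sym (map-tabulate (λ i → i) F.suc))) (countᵇ-map p F.suc (allFin n))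

  ∣∣≡countᵇ : {m : ℕ} (p : Subset m) → ∣ p ∣ ≡ countᵇ (lookup p) (allFin m)
  ∣∣≡countᵇ [] = refl
  ∣∣≡countᵇ (true ∷ p) = cong suc (trans (∣∣≡countᵇ p) (sym (countᵇ-tabulate-suc (lookup (true ∷ p)))))
  ∣∣≡countᵇ (false ∷ p) = trans (∣∣≡countᵇ p) (sym (countᵇ-tabulate-suc (lookup (false ∷ p))))

  lookup-⁅x⁆-x : {m : ℕ} (x : Fin m) → lookup ⁅ x ⁆ x ≡ true
  lookup-⁅x⁆-x x = []=⇒lookup (x∈⁅x⁆ x)

  lookup-⁅x⁆⇒≡ : {m : ℕ} (x y : Fin m) → lookup ⁅ x ⁆ y ≡ true → y ≡ x
  lookup-⁅x⁆⇒≡ x y h = x∈⁅y⁆⇒x≡y x (lookup⇒[]= y ⁅ x ⁆ h)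

  lookup-─ : {m : ℕ} (p q : Subset m) (x : Fin m) → lookup (p ─ q) x ≡ lookup p x ∧ not (lookup q x)
  lookup-─ (a ∷ p) (true  ∷ q) F.zero = sym (∧-zeroʳ a)
  lookup-─ (a ∷ p) (false ∷ q) F.zero = sym (∧-identityʳ a)
  lookup-─ (a ∷ p) (b ∷ q) (F.suc x) = lookup-─ p q x

  ∣─∣+∣∣≡∣∣ : {m : ℕ} (p q : Subset m) → (∀ x → lookup q x ≡ true → lookup p x ≡ true) →
    ∣ p ─ q ∣ + ∣ q ∣ ≡ ∣ p ∣
  ∣─∣+∣∣≡∣∣ [] [] _ = refl
  ∣─∣+∣∣≡∣∣ (true ∷ p) (true ∷ q) q⊆p = trans (+-suc _ _) (cong suc (∣─∣+∣∣≡∣∣ p q (q⊆p ∘ F.suc)))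
  ∣─∣+∣∣≡∣∣ (true ∷ p) (false ∷ q) q⊆p = cong suc (∣─∣+∣∣≡∣∣ p q (q⊆p ∘ F.suc))
  ∣─∣+∣∣≡∣∣ (false ∷ p) (false ∷ q) q⊆p = ∣─∣+∣∣≡∣∣ p q (q⊆p ∘ F.suc)
  ∣─∣+∣∣≡∣∣ (false ∷ p) (true ∷ q) q⊆p with () ← q⊆p F.zero refl

  ∣─∣≡ : {m : ℕ} (p q : Subset m) (b : ℕ) → (∀ x → lookup q x ≡ true → lookup p x ≡ true) →
    ∣ q ∣ + b ≡ ∣ p ∣ → ∣ p ─ q ∣ ≡ b
  ∣─∣≡ p q b q⊆p ∣q∣+b≡∣p∣ = +-cancelˡ-≡ ∣ q ∣ _ _
    (trans (+-comm ∣ q ∣ ∣ p ─ q ∣) (trans (∣─∣+∣∣≡∣∣ p q q⊆p) (sym ∣q∣+b≡∣p∣)))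

  module _ {m : ℕ} where

    lookup-─⇒ : (p q : Subset m) (y : Fin m) → lookup (p ─ q) y ≡ true → lookup p y ≡ true
    lookup-─⇒ p q y h = ∧≡true⁻ (trans (sym (lookup-─ p q y)) h) .proj₁

    lookup-─-removed : (p q : Subset m) (y : Fin m) → lookup q y ≡ true → lookup (p ─ q) y ≡ false
    lookup-─-removed p q y y∈q rewrite lookup-─ p q y | y∈q = ∧-zeroʳ (lookup p y)

    lookup-─-kept : (p q : Subset m) (y : Fin m) → lookup p y ≡ true → lookup q y ≡ false → lookup (p ─ q) y ≡ true
    lookup-─-kept p q y y∈p y∉q rewrite lookup-─ p q y | y∈p | y∉q = refl

    lookup-─-absent : (p q : Subset m) (y : Fin m) → lookup p y ≡ false → lookup (p ─ q) y ≡ false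
    lookup-─-absent p q y y∉p rewrite lookup-─ p q y | y∉p = refl

    suc∣─⁅x⁆∣≡∣∣ : (p : Subset m) (x : Fin m) → lookup p x ≡ true → suc ∣ p ─ ⁅ x ⁆ ∣ ≡ ∣ p ∣
    suc∣─⁅x⁆∣≡∣∣ p x x∈p = begin
      suc ∣ p ─ ⁅ x ⁆ ∣         ≡⟨ +-comm 1 _ ⟩
      ∣ p ─ ⁅ x ⁆ ∣ + 1         ≡⟨ cong (∣ p ─ ⁅ x ⁆ ∣ +_) (∣⁅x⁆∣≡1 x) ⟨
      ∣ p ─ ⁅ x ⁆ ∣ + ∣ ⁅ x ⁆ ∣ ≡⟨ ∣─∣+∣∣≡∣∣ p ⁅ x ⁆ ⁅x⁆⊆p ⟩
      ∣ p ∣                     ∎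
      where
      open ≡-Reasoning
      ⁅x⁆⊆p : ∀ y → lookup ⁅ x ⁆ y ≡ true → lookup p y ≡ true
      ⁅x⁆⊆p y y∈⁅x⁆ = subst (λ z → lookup p z ≡ true) (sym (lookup-⁅x⁆⇒≡ x y y∈⁅x⁆)) x∈p

  -- Boxes and fibres

  ∈-allCrossing : {r m : ℕ} (e : Crossing r m) → e ∈ allCrossing r m
  ∈-allCrossing {zero} [] = here refl
  ∈-allCrossing {suc r} {m} (x ∷ e) =
    ∈-concatMap⁺ (λ y → map (y ∷_) (allCrossing r m)) (lose (∈-allFin x) (∈-map⁺ (x ∷_) (∈-allCrossing e)))

  module _ {r m : ℕ} where

    inAll-∷ : (A : Fin (suc r) → Subset m) (x : Fin m) (e : Crossing r m) →
      inAll A (x ∷ e) ≡ lookup (A F.zero) x ∧ inAll (A ∘ F.suc) e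
    inAll-∷ A x e = cong (λ l → lookup (A F.zero) x ∧ foldr _∧_ true l)
      (trans (map-tabulate {n = r} F.suc (λ i → lookup (A i) (lookup (x ∷ e) i)))
             (sym (map-tabulate {n = r} (λ i → i) (λ i → lookup (A (F.suc i)) (lookup e i)))))

    prodSizes-∷ : (A : Fin (suc r) → Subset m) → prodSizes A ≡ ∣ A F.zero ∣ * prodSizes (A ∘ F.suc)
    prodSizes-∷ A = cong (λ l → ∣ A F.zero ∣ * foldr ℕ._*_ 1 l)
      (trans (map-tabulate {n = r} F.suc (λ i → ∣ A i ∣))
             (sym (map-tabulate {n = r} (λ i → i) (λ i → ∣ A (F.suc i) ∣))))

  inAll⁻ : {r m : ℕ} (A : Fin r → Subset m) (e : Crossing r m) →
    inAll A e ≡ true → ∀ i → lookup (A i) (lookup e i) ≡ true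
  inAll⁻ A (x ∷ e) h i with lookup (A F.zero) x in a | inAll-∷ A x e
  inAll⁻ A (x ∷ e) h F.zero    | true | _ = a
  inAll⁻ A (x ∷ e) h (F.suc i) | true | eq = inAll⁻ (A ∘ F.suc) e (trans (sym eq) h) i
  inAll⁻ A (x ∷ e) h i         | false | eq with () ← trans (sym h) eq

  inAll⁺ : {r m : ℕ} (A : Fin r → Subset m) (e : Crossing r m) →
    (∀ i → lookup (A i) (lookup e i) ≡ true) → inAll A e ≡ true
  inAll⁺ A [] h = refl
  inAll⁺ A (x ∷ e) h rewrite inAll-∷ A x e | h F.zero = inAll⁺ (A ∘ F.suc) e (h ∘ F.suc)

  inAll-cong : {r m : ℕ} (A B : Fin r → Subset m) → (∀ i → A i ≡ B i) → (e : Crossing r m) → inAll A e ≡ inAll B e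
  inAll-cong A B h [] = refl
  inAll-cong A B h (x ∷ e) = begin
    inAll A (x ∷ e)                                ≡⟨ inAll-∷ A x e ⟩
    lookup (A F.zero) x ∧ inAll (A ∘ F.suc) e      ≡⟨ cong₂ (λ S b → lookup S x ∧ b) (h F.zero) (inAll-cong _ _ (h ∘ F.suc) e) ⟩
    lookup (B F.zero) x ∧ inAll (B ∘ F.suc) e      ≡⟨ inAll-∷ B x e ⟨
    inAll B (x ∷ e)                                ∎
    where open ≡-Reasoning

  countᵇ-inAll≡prodSizes : {r m : ℕ} (A : Fin r → Subset m) → countᵇ (inAll A) (allCrossing r m) ≡ prodSizes A
  countᵇ-inAll≡prodSizes {zero} A = refl
  countᵇ-inAll≡prodSizes {suc r} {m} A = begin
    countᵇ (inAll A) (allCrossing (suc r) m)                   ≡⟨ slices (allFin m) ⟩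
    countᵇ (lookup (A F.zero)) (allFin m) * countᵇ (inAll (A ∘ F.suc)) (allCrossing r m)
      ≡⟨ cong₂ _*_ (sym (∣∣≡countᵇ (A F.zero))) (countᵇ-inAll≡prodSizes (A ∘ F.suc)) ⟩
    ∣ A F.zero ∣ * prodSizes (A ∘ F.suc)                       ≡⟨ prodSizes-∷ A ⟨
    prodSizes A                                                 ∎
    where
    open ≡-Reasoning
    rest = countᵇ (inAll (A ∘ F.suc)) (allCrossing r m)
    slice : (x : Fin m) → countᵇ (inAll A) (map (x ∷_) (allCrossing r m)) ≡ (if lookup (A F.zero) x then rest else 0)
    slice x = trans (countᵇ-map (inAll A) (x ∷_) (allCrossing r m))
      (trans (countᵇ-cong _ _ (allCrossing r m) (inAll-∷ A x)) (countᵇ-const-∧ (lookup (A F.zero) x) _ (allCrossing r m)))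
    slices : (xs : List (Fin m)) → countᵇ (inAll A) (concatMap (λ x → map (x ∷_) (allCrossing r m)) xs)
                                   ≡ countᵇ (lookup (A F.zero)) xs * rest
    slices [] = refl
    slices (x ∷ xs) = begin
      countᵇ (inAll A) (map (x ∷_) (allCrossing r m) ++ _)
        ≡⟨ countᵇ-++ (inAll A) (map (x ∷_) (allCrossing r m)) _ ⟩
      countᵇ (inAll A) (map (x ∷_) (allCrossing r m)) + _
        ≡⟨ cong₂ _+_ (slice x) (slices xs) ⟩
      (if lookup (A F.zero) x then rest else 0) + countᵇ (lookup (A F.zero)) xs * rest
        ≡⟨ add-slice (lookup (A F.zero) x) refl ⟩
      countᵇ (lookup (A F.zero)) (x ∷ xs) * rest ∎
      where
      add-slice : (b : Bool) → lookup (A F.zero) x ≡ b →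
        (if b then rest else 0) + countᵇ (lookup (A F.zero)) xs * rest ≡ countᵇ (lookup (A F.zero)) (x ∷ xs) * rest
      add-slice true  ax rewrite ax = refl
      add-slice false ax rewrite ax = refl

  prodSizes-const : {r m : ℕ} (A : Fin r → Subset m) (u : ℕ) → (∀ i → ∣ A i ∣ ≡ u) → prodSizes A ≡ u ^ r
  prodSizes-const {zero} A u h = refl
  prodSizes-const {suc r} A u h = trans (prodSizes-∷ A) (cong₂ _*_ (h F.zero) (prodSizes-const (A ∘ F.suc) u (h ∘ F.suc)))

  prodSizes-single-factor : {r m : ℕ} (A : Fin r → Subset m) (j : Fin r) →
    (∀ i → i ≢ j → ∣ A i ∣ ≡ 1) → prodSizes A ≡ ∣ A j ∣
  prodSizes-single-factor {suc r} A F.zero h = begin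
    prodSizes A                          ≡⟨ prodSizes-∷ A ⟩
    ∣ A F.zero ∣ * prodSizes (A ∘ F.suc) ≡⟨ cong (∣ A F.zero ∣ *_) (prodSizes-const (A ∘ F.suc) 1 (λ i → h (F.suc i) λ ())) ⟩
    ∣ A F.zero ∣ * 1 ^ r                 ≡⟨ cong (∣ A F.zero ∣ *_) (^-zeroˡ r) ⟩
    ∣ A F.zero ∣ * 1                     ≡⟨ *-identityʳ _ ⟩
    ∣ A F.zero ∣                         ∎
    where open ≡-Reasoning
  prodSizes-single-factor {suc r} A (F.suc j) h = begin
    prodSizes A                          ≡⟨ prodSizes-∷ A ⟩
    ∣ A F.zero ∣ * prodSizes (A ∘ F.suc) ≡⟨ cong₂ _*_ (h F.zero λ ())
                                             (prodSizes-single-factor (A ∘ F.suc) j λ i i≢j → h (F.suc i) (i≢j ∘ Fin.suc-injective)) ⟩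
    1 * ∣ A (F.suc j) ∣                  ≡⟨ *-identityˡ _ ⟩
    ∣ A (F.suc j) ∣                      ∎
    where open ≡-Reasoning

  module _ {r m : ℕ} where

    -- the box whose crossings agree with c off coordinate j and have their j-th vertex in W j
    fibre : (Fin r → Subset m) → Fin r → Crossing r m → Fin r → Subset m
    fibre W j c = updateAt (λ i → ⁅ lookup c i ⁆) j (λ _ → W j)

    fibre-at : (W : Fin r → Subset m) (j : Fin r) (c : Crossing r m) → fibre W j c j ≡ W j
    fibre-at W j c = updateAt-updates j (λ i → ⁅ lookup c i ⁆)

    fibre-off : (W : Fin r → Subset m) {i j : Fin r} (c : Crossing r m) → i ≢ j → fibre W j c i ≡ ⁅ lookup c i ⁆
    fibre-off W {i} {j} c i≢j = updateAt-minimal i j (λ i → ⁅ lookup c i ⁆) i≢j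

    inAll-fibre⁻ : (W : Fin r → Subset m) (j : Fin r) (c c' : Crossing r m) → inAll (fibre W j c) c' ≡ true →
      lookup (W j) (lookup c' j) ≡ true × (∀ i → i ≢ j → lookup c' i ≡ lookup c i)
    inAll-fibre⁻ W j c c' h =
      subst (λ S → lookup S (lookup c' j) ≡ true) (fibre-at W j c) (inAll⁻ (fibre W j c) c' h j) ,
      λ i i≢j → lookup-⁅x⁆⇒≡ (lookup c i) (lookup c' i)
                  (subst (λ S → lookup S (lookup c' i) ≡ true) (fibre-off W c i≢j) (inAll⁻ (fibre W j c) c' h i))

    inAll-fibre⁺ : (W : Fin r → Subset m) (j : Fin r) (c c' : Crossing r m) → lookup (W j) (lookup c' j) ≡ true →
      (∀ i → i ≢ j → lookup c' i ≡ lookup c i) → inAll (fibre W j c) c' ≡ true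
    inAll-fibre⁺ W j c c' c'ⱼ∈W agree = inAll⁺ (fibre W j c) c' member
      where
      member : ∀ i → lookup (fibre W j c i) (lookup c' i) ≡ true
      member i with i F.≟ j
      ... | yes refl rewrite fibre-at W i c = c'ⱼ∈W
      ... | no i≢j rewrite fibre-off W c i≢j | agree i i≢j = lookup-⁅x⁆-x (lookup c i)

    inAll-fibre-self : (W : Fin r → Subset m) (j : Fin r) (c : Crossing r m) → lookup (W j) (lookup c j) ≡ true →
      inAll (fibre W j c) c ≡ true
    inAll-fibre-self W j c cⱼ∈W = inAll-fibre⁺ W j c c cⱼ∈W (λ _ _ → refl)

    fibre-of-member : (W : Fin r → Subset m) (j : Fin r) (c c' : Crossing r m) → inAll (fibre W j c) c' ≡ true →
      ∀ c'' → inAll (fibre W j c') c'' ≡ inAll (fibre W j c) c''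
    fibre-of-member W j c c' h = inAll-cong (fibre W j c') (fibre W j c) same
      where
      same : ∀ i → fibre W j c' i ≡ fibre W j c i
      same i with i F.≟ j
      ... | yes refl = trans (fibre-at W i c') (sym (fibre-at W i c))
      ... | no i≢j = trans (fibre-off W c' i≢j) (trans (cong ⁅_⁆ (proj₂ (inAll-fibre⁻ W j c c' h) i i≢j)) (sym (fibre-off W c i≢j)))

    countᵇ-fibre : (W : Fin r → Subset m) (j : Fin r) (c : Crossing r m) →
      countᵇ (inAll (fibre W j c)) (allCrossing r m) ≡ ∣ W j ∣
    countᵇ-fibre W j c = trans (countᵇ-inAll≡prodSizes (fibre W j c))
      (trans (prodSizes-single-factor (fibre W j c) j (λ i i≢j → trans (cong ∣_∣ (fibre-off W c i≢j)) (∣⁅x⁆∣≡1 (lookup c i))))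
             (cong ∣_∣ (fibre-at W j c)))

    fibre⊆box : (U : Fin r → Subset m) (j : Fin r) (c c' : Crossing r m) → inAll U c ≡ true →
      inAll (fibre U j c) c' ≡ true → inAll U c' ≡ true
    fibre⊆box U j c c' c∈U c'∈fibre = inAll⁺ U c' member
      where
      member : ∀ i → lookup (U i) (lookup c' i) ≡ true
      member i with i F.≟ j
      ... | yes refl = proj₁ (inAll-fibre⁻ U i c c' c'∈fibre)
      ... | no i≢j rewrite proj₂ (inAll-fibre⁻ U j c c' c'∈fibre) i i≢j = inAll⁻ U c c∈U i

  -- Pruning light fibres

  sum-map-≤ : {A : Set} (f : A → ℕ) (B : ℕ) (xs : List A) → (∀ x → f x ≤ B) → sum (map f xs) ≤ length xs * B
  sum-map-≤ f B [] h = z≤n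
  sum-map-≤ f B (x ∷ xs) h = +-mono-≤ (h x) (sum-map-≤ f B xs h)

  sum-map-mono : {A : Set} (f g : A → ℕ) (xs : List A) → (∀ x → f x ≤ g x) → sum (map f xs) ≤ sum (map g xs)
  sum-map-mono f g [] h = z≤n
  sum-map-mono f g (x ∷ xs) h = +-mono-≤ (h x) (sum-map-mono f g xs h)

  sum-map-drop : {A : Set} (f g : A → ℕ) (d : ℕ) {x₀ : A} (xs : List A) → x₀ ∈ xs →
    (∀ x → f x ≤ g x) → f x₀ + d ≤ g x₀ → sum (map f xs) + d ≤ sum (map g xs)
  sum-map-drop f g d (x ∷ xs) (here refl) f≤g drop = begin
    f x + sum (map f xs) + d ≡⟨ +-comm (f x + _) d ⟩
    d + (f x + sum (map f xs)) ≡⟨ +-assoc d (f x) _ ⟨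
    d + f x + sum (map f xs)   ≤⟨ +-mono-≤ (≤-trans (≤-reflexive (+-comm d (f x))) drop) (sum-map-mono f g xs f≤g) ⟩
    g x + sum (map g xs)       ∎
    where open ≤-Reasoning
  sum-map-drop f g d (x ∷ xs) (there x₀∈xs) f≤g drop = begin
    f x + sum (map f xs) + d   ≡⟨ +-assoc (f x) _ d ⟩
    f x + (sum (map f xs) + d) ≤⟨ +-mono-≤ (f≤g x) (sum-map-drop f g d xs x₀∈xs f≤g drop) ⟩
    g x + sum (map g xs)       ∎
    where open ≤-Reasoning

  module Pruning {r m : ℕ} (U : Fin r → Subset m) (u : ℕ) (∣U∣≡u : ∀ i → ∣ U i ∣ ≡ u) (t : ℕ) where

    EdgeSet : Set
    EdgeSet = Crossing r m → Bool

    _⊆ₑ_ : EdgeSet → EdgeSet → Set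
    E' ⊆ₑ E = ∀ c → E' c ≡ true → E c ≡ true

    size : EdgeSet → ℕ
    size E = countᵇ E (allCrossing r m)

    degree : EdgeSet → Fin r → Crossing r m → ℕ
    degree E j c = countᵇ (λ c' → E c' ∧ inAll (fibre U j c) c') (allCrossing r m)

    live : EdgeSet → Fin r → Crossing r m → Bool
    live E j c = 0 <ᵇ degree E j c

    live⁺ : ∀ E j c → 0 < degree E j c → live E j c ≡ true
    live⁺ E j c h = Equivalence.to T-≡ (<⇒<ᵇ h)

    live⁻ : ∀ E j c → live E j c ≡ true → 0 < degree E j c
    live⁻ E j c h = <ᵇ⇒< 0 _ (Equivalence.from T-≡ h)

    -- each live j-fibre inside the box is counted once for each of its u crossings
    liveCount : EdgeSet → Fin r → ℕ
    liveCount E j = countᵇ (λ c → inAll U c ∧ live E j c) (allCrossing r m)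

    liveTotal : EdgeSet → ℕ
    liveTotal E = sum (map (liveCount E) (allFin r))

    Dense : EdgeSet → Set
    Dense E = t * liveTotal E < u * size E

    MinDegree : EdgeSet → Set
    MinDegree E = ∀ j c → inAll U c ≡ true → live E j c ≡ true → t < degree E j c

    liveTotal≤ : (E : EdgeSet) → liveTotal E ≤ r * u ^ r
    liveTotal≤ E = subst (λ k → liveTotal E ≤ k * u ^ r) (length-tabulate {n = r} (λ i → i))
      (sum-map-≤ (liveCount E) (u ^ r) (allFin r) λ j →
        subst (liveCount E j ≤_) (trans (countᵇ-inAll≡prodSizes U) (prodSizes-const U u ∣U∣≡u))
          (countᵇ-mono _ (inAll U) (allCrossing r m) (λ c h → ∧≡true⁻ h .proj₁)))

    degree-mono : (E' E : EdgeSet) → E' ⊆ₑ E → ∀ j c → degree E' j c ≤ degree E j c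
    degree-mono E' E E'⊆E j c = countᵇ-mono _ _ (allCrossing r m) λ c' h →
      let (c'∈E' , c'∈fibre) = ∧≡true⁻ h in cong₂ _∧_ (E'⊆E c' c'∈E') c'∈fibre

    live-mono : (E' E : EdgeSet) → E' ⊆ₑ E → ∀ j c → live E' j c ≡ true → live E j c ≡ true
    live-mono E' E E'⊆E j c h = live⁺ E j c (≤-trans (live⁻ E' j c h) (degree-mono E' E E'⊆E j c))

    liveCount-mono : (E' E : EdgeSet) → E' ⊆ₑ E → ∀ j → liveCount E' j ≤ liveCount E j
    liveCount-mono E' E E'⊆E j = countᵇ-mono _ _ (allCrossing r m) λ c h →
      let (c∈U , c-live) = ∧≡true⁻ h in cong₂ _∧_ c∈U (live-mono E' E E'⊆E j c c-live)

    module DeleteFibre (E : EdgeSet) (j₀ : Fin r) (c₀ : Crossing r m)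
                       (c₀∈U : inAll U c₀ ≡ true) (c₀-live : 0 < degree E j₀ c₀) where

      inFibre : Crossing r m → Bool
      inFibre = inAll (fibre U j₀ c₀)

      E' : EdgeSet
      E' c = E c ∧ not (inFibre c)

      E'⊆E : E' ⊆ₑ E
      E'⊆E c h = ∧≡true⁻ h .proj₁

      size-split : size E ≡ degree E j₀ c₀ + size E'
      size-split = countᵇ-split E inFibre (allCrossing r m)

      size-drop : size E' < size E
      size-drop = subst (size E' <_) (sym size-split) (+-monoˡ-≤ (size E') c₀-live)

      degree-on-fibre : ∀ E″ c → inFibre c ≡ true → degree E″ j₀ c ≡ degree E″ j₀ c₀
      degree-on-fibre E″ c h = countᵇ-cong _ _ (allCrossing r m) λ c' → cong (E″ c' ∧_) (fibre-of-member U j₀ c₀ c h c')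

      fibre-dead : ∀ c → inFibre c ≡ true → live E' j₀ c ≡ false
      fibre-dead c h = cong (0 <ᵇ_) (trans (degree-on-fibre E' c h) (countᵇ-none _ (allCrossing r m) excluded))
        where
        excluded : ∀ c' → (E c' ∧ not (inFibre c')) ∧ inFibre c' ≡ false
        excluded c' with inFibre c' | E c'
        ... | true  | true  = refl
        ... | true  | false = refl
        ... | false | true  = refl
        ... | false | false = refl

      liveCount-drop : liveCount E' j₀ + u ≤ liveCount E j₀
      liveCount-drop = begin
        liveCount E' j₀ + u                                 ≡⟨ cong (liveCount E' j₀ +_) (trans (countᵇ-fibre U j₀ c₀) (∣U∣≡u j₀)) ⟨
        liveCount E' j₀ + countᵇ inFibre (allCrossing r m)  ≤⟨ +-mono-≤ (countᵇ-mono _ _ (allCrossing r m) outside)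
                                                                         (countᵇ-mono _ _ (allCrossing r m) inside) ⟩
        countᵇ (λ c → L c ∧ not (inFibre c)) (allCrossing r m) + countᵇ (λ c → L c ∧ inFibre c) (allCrossing r m)
                                                            ≡⟨ +-comm (countᵇ (λ c → L c ∧ not (inFibre c)) (allCrossing r m)) _ ⟩
        countᵇ (λ c → L c ∧ inFibre c) (allCrossing r m) + countᵇ (λ c → L c ∧ not (inFibre c)) (allCrossing r m)
                                                            ≡⟨ countᵇ-split L inFibre (allCrossing r m) ⟨
        liveCount E j₀                                      ∎
        where
        open ≤-Reasoning
        L : Crossing r m → Bool
        L c = inAll U c ∧ live E j₀ c
        inside : ∀ c → inFibre c ≡ true → L c ∧ inFibre c ≡ true
        inside c h = ∧≡true⁺ (∧≡true⁺ (fibre⊆box U j₀ c₀ c c₀∈U h)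
                                       (trans (cong (0 <ᵇ_) (degree-on-fibre E c h)) (live⁺ E j₀ c₀ c₀-live))) h
        off-fibre : ∀ c → live E' j₀ c ≡ true → inFibre c ≡ false
        off-fibre c c-live with inFibre c in c∈F
        ... | true with () ← trans (sym c-live) (fibre-dead c c∈F)
        ... | false = refl
        outside : ∀ c → inAll U c ∧ live E' j₀ c ≡ true → L c ∧ not (inFibre c) ≡ true
        outside c h = let (c∈U , c-live) = ∧≡true⁻ h in
          ∧≡true⁺ (∧≡true⁺ c∈U (live-mono E' E E'⊆E j₀ c c-live)) (cong not (off-fibre c c-live))

      liveTotal-drop : liveTotal E' + u ≤ liveTotal E
      liveTotal-drop = sum-map-drop (liveCount E') (liveCount E) u (allFin r) (∈-allFin j₀)
                         (liveCount-mono E' E E'⊆E) liveCount-drop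

      dense-preserved : degree E j₀ c₀ ≤ t → Dense E → Dense E'
      dense-preserved deg≤t dense = +-cancelʳ-< (t * u) (t * liveTotal E') (u * size E') (begin-strict
        t * liveTotal E' + t * u    ≡⟨ *-distribˡ-+ t (liveTotal E') u ⟨
        t * (liveTotal E' + u)      ≤⟨ *-monoʳ-≤ t liveTotal-drop ⟩
        t * liveTotal E             <⟨ dense ⟩
        u * size E                  ≡⟨ cong (u *_) size-split ⟩
        u * (degree E j₀ c₀ + size E') ≡⟨ *-distribˡ-+ u _ _ ⟩
        u * degree E j₀ c₀ + u * size E' ≤⟨ +-monoˡ-≤ _ (*-monoʳ-≤ u deg≤t) ⟩
        u * t + u * size E'         ≡⟨ cong (_+ u * size E') (*-comm u t) ⟩
        t * u + u * size E'         ≡⟨ +-comm (t * u) _ ⟩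
        u * size E' + t * u         ∎)
        where open ≤-Reasoning

    dense⇒size>0 : (E : EdgeSet) → Dense E → 0 < size E
    dense⇒size>0 E dense = n≢0⇒n>0 λ size≡0 →
      n≮0 (subst (t * liveTotal E <_) (trans (cong (u *_) size≡0) (*-zeroʳ u)) dense)

    Light : EdgeSet → Fin r → Crossing r m → Set
    Light E j c = inAll U c ≡ true × 0 < degree E j c × degree E j c ≤ t

    light? : ∀ E j c → Dec (Light E j c)
    light? E j c = (inAll U c ≟ᵇ true) ×-dec (0 <? degree E j c) ×-dec (degree E j c ≤? t)

    light-or-minDegree : (E : EdgeSet) → (Σ (Fin r) λ j → Σ (Crossing r m) (Light E j)) ⊎ MinDegree E
    light-or-minDegree E with Fin.any? (λ j → any? (light? E j) (allCrossing r m))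
    ... | yes (j , light) = inj₁ (j , satisfied light)
    ... | no none = inj₂ λ j c c∈U c-live → ≰⇒> λ deg≤t →
            none (j , lose (∈-allCrossing c) (c∈U , live⁻ E j c c-live , deg≤t))

    prune : (n : ℕ) (E : EdgeSet) → size E ≤ n → Dense E → Σ EdgeSet λ E' → E' ⊆ₑ E × Dense E' × MinDegree E'
    prune n E size≤n dense with light-or-minDegree E
    ... | inj₂ minDegree = E , (λ _ h → h) , dense , minDegree
    prune zero E size≤0 dense | inj₁ _ = contradiction (dense⇒size>0 E dense) (<-irrefl (sym (n≤0⇒n≡0 size≤0)))
    prune (suc n) E size≤n dense | inj₁ (j , c , c∈U , c-live , deg≤t) =
      let open DeleteFibre E j c c∈U c-live
          (E″ , E″⊆E' , dense″ , minDegree) = prune n E' (s≤s⁻¹ (<-≤-trans size-drop size≤n)) (dense-preserved deg≤t dense)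
      in E″ , (λ c' h → E'⊆E c' (E″⊆E' c' h)) , dense″ , minDegree

  -- Tight walks through consecutive blocks

  module _ {A : Set} where

    ∈-take-mono : {x : A} (s : ℕ) (xs ys : List A) → x ∈ take s xs → x ∈ take s (xs ++ ys)
    ∈-take-mono (suc s) (x ∷ xs) ys (here p) = here p
    ∈-take-mono (suc s) (x ∷ xs) ys (there p) = there (∈-take-mono s xs ys p)

    ∈-take-++⁺ˡ : {x : A} (n : ℕ) (xs ys : List A) → x ∈ xs → length xs ≤ n → x ∈ take n (xs ++ ys)
    ∈-take-++⁺ˡ (suc n) (x ∷ xs) ys (here p) _ = here p
    ∈-take-++⁺ˡ (suc n) (x ∷ xs) ys (there p) (s≤s h) = there (∈-take-++⁺ˡ n xs ys p h)

    ∈-take-++⁺ʳ : {x : A} (s : ℕ) (xs ys : List A) → x ∈ take s ys → x ∈ take (length xs + s) (xs ++ ys)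
    ∈-take-++⁺ʳ s [] ys p = p
    ∈-take-++⁺ʳ s (x ∷ xs) ys p = there (∈-take-++⁺ʳ s xs ys p)

    windows-++ : (k : ℕ) (xs zs w : List A) → w ∈ windows k (xs ++ zs) →
      w ∈ windows k zs ⊎ Σ ℕ λ s → s < length xs × w ≡ take k (drop s xs ++ zs) × k ≤ length (drop s xs ++ zs)
    windows-++ k [] zs w h = inj₁ h
    windows-++ k (x ∷ xs) zs w h with k ≤ᵇ suc (length (xs ++ zs)) in fits
    windows-++ k (x ∷ xs) zs w (here refl) | true = inj₂ (0 , s≤s z≤n , refl , ≤ᵇ⇒≤ k _ (Equivalence.from T-≡ fits))
    windows-++ k (x ∷ xs) zs w (there h)   | true with windows-++ k xs zs w h
    ... | inj₁ p = inj₁ p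
    ... | inj₂ (s , s<∣xs∣ , w≡ , k≤) = inj₂ (suc s , s≤s s<∣xs∣ , w≡ , k≤)

  ∈-drop-allFin : {n : ℕ} (s : ℕ) (i : Fin n) → s ≤ toℕ i → i ∈ drop s (allFin n)
  ∈-drop-allFin zero i _ = ∈-allFin i
  ∈-drop-allFin {suc n} (suc s) (F.suc i) (s≤s s≤i)
    rewrite sym (map-tabulate {n = n} (λ i → i) F.suc) | drop-map {f = F.suc} s (allFin n) =
    ∈-map⁺ F.suc (∈-drop-allFin s i s≤i)

  ∈-take-allFin : {n : ℕ} (s : ℕ) (i : Fin n) → toℕ i < s → i ∈ take s (allFin n)
  ∈-take-allFin {suc n} (suc s) F.zero _ = here refl
  ∈-take-allFin {suc n} (suc s) (F.suc i) (s≤s i<s)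
    rewrite sym (map-tabulate {n = n} (λ i → i) F.suc) | take-map {f = F.suc} s (allFin n) =
    there (∈-map⁺ F.suc (∈-take-allFin s i i<s))

  module _ {r m : ℕ} where

    vertices : Crossing r m → List (Vertex r m)
    vertices g = map (λ i → i , lookup g i) (allFin r)

    length-vertices : (g : Crossing r m) → length (vertices g) ≡ r
    length-vertices g = trans (length-map _ (allFin r)) (length-tabulate {n = r} (λ i → i))

    ∈-vertices⁻ : (g : Crossing r m) {v : Vertex r m} → v ∈ vertices g → proj₂ v ≡ lookup g (proj₁ v)
    ∈-vertices⁻ g v∈ with ∈-map⁻ (λ i → i , lookup g i) v∈
    ... | i , _ , refl = refl

    ∈-drop-vertices : (g : Crossing r m) (s : ℕ) (i : Fin r) → s ≤ toℕ i → (i , lookup g i) ∈ drop s (vertices g)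
    ∈-drop-vertices g s i s≤i rewrite drop-map {f = λ i → i , lookup g i} s (allFin r) = ∈-map⁺ _ (∈-drop-allFin s i s≤i)

    ∈-take-vertices : (g : Crossing r m) (s : ℕ) (i : Fin r) → toℕ i < s → (i , lookup g i) ∈ take s (vertices g)
    ∈-take-vertices g s i i<s rewrite take-map {f = λ i → i , lookup g i} s (allFin r) = ∈-map⁺ _ (∈-take-allFin s i i<s)

  TightWalk : {r m : ℕ} → RGraph r m → List (Vertex r m) → Set
  TightWalk {r} H p = ∀ w → w ∈ windows r p → IsEdgeOf H w

  module _ {r m : ℕ} (H : RGraph r m) where

    -- the window of vertices g' ++ vertices g starting at position s is the edge e
    Linked : Crossing r m → Crossing r m → Set
    Linked g' g = ∀ s → s < r → Σ (Crossing r m) λ e → H e ≡ true ×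
      (∀ i → s ≤ toℕ i → lookup e i ≡ lookup g' i) × (∀ i → toℕ i < s → lookup e i ≡ lookup g i)

    tight-∷ : (g' g : Crossing r m) (p : List (Vertex r m)) → TightWalk H (vertices g ++ p) → Linked g' g →
      TightWalk H (vertices g' ++ vertices g ++ p)
    tight-∷ g' g p tight linked w w∈ with windows-++ r (vertices g') (vertices g ++ p) w w∈
    ... | inj₁ w∈tail = tight w w∈tail
    ... | inj₂ (s , s<∣g'∣ , refl , r≤len) = e , He , length-window , member
      where
      s<r = subst (s <_) (length-vertices g') s<∣g'∣
      ys = drop s (vertices g')
      zs = vertices g ++ p
      ∣ys∣ : length ys ≡ r ∸ s
      ∣ys∣ = trans (length-drop s (vertices g')) (cong (_∸ s) (length-vertices g'))
      linked-s = linked s s<r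
      e = proj₁ linked-s
      He = proj₁ (proj₂ linked-s)
      length-window : length (take r (ys ++ zs)) ≡ r
      length-window = trans (length-take r (ys ++ zs)) (m≤n⇒m⊓n≡m r≤len)
      member : ∀ i → (i , lookup e i) ∈ take r (ys ++ zs)
      member i with s ≤? toℕ i
      ... | yes s≤i rewrite proj₁ (proj₂ (proj₂ linked-s)) i s≤i =
            ∈-take-++⁺ˡ r ys zs (∈-drop-vertices g' s i s≤i) (≤-trans (≤-reflexive ∣ys∣) (m∸n≤m r s))
      ... | no s≰i rewrite proj₂ (proj₂ (proj₂ linked-s)) i (≰⇒> s≰i) =
            subst (λ n → (i , lookup g i) ∈ take n (ys ++ zs)) (trans (cong (_+ s) ∣ys∣) (m∸n+n≡m (<⇒≤ s<r)))
              (∈-take-++⁺ʳ s ys zs (∈-take-mono s (vertices g) p (∈-take-vertices g s i (≰⇒> s≰i))))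

  tight-single : {r m : ℕ} (H : RGraph (suc r) m) (g : Crossing (suc r) m) → H g ≡ true → TightWalk H (vertices g)
  tight-single {r} H g Hg w w∈
    with windows-++ (suc r) (vertices g) [] w (subst (λ p → w ∈ windows (suc r) p) (sym (++-identityʳ (vertices g))) w∈)
  ... | inj₂ (zero , _ , refl , r≤len) =
    g , Hg , trans (length-take (suc r) (vertices g ++ [])) (m≤n⇒m⊓n≡m r≤len) ,
    λ i → ∈-take-++⁺ˡ (suc r) (vertices g) [] (∈-drop-vertices g 0 i z≤n) (≤-reflexive (length-vertices g))
  ... | inj₂ (suc s , _ , refl , r≤len) = contradiction r≤len (<⇒≱ (begin-strict
    length (drop (suc s) (vertices g) ++ []) ≡⟨ cong length (++-identityʳ (drop (suc s) (vertices g))) ⟩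
    length (drop (suc s) (vertices g))       ≡⟨ length-drop (suc s) (vertices g) ⟩
    length (vertices g) ∸ suc s              ≡⟨ cong (_∸ suc s) (length-vertices g) ⟩
    r ∸ s                                    ≤⟨ m∸n≤m r s ⟩
    r                                        <⟨ n<1+n r ⟩
    suc r                                    ∎))
    where open ≤-Reasoning

  -- Growing one path

  module _ {r m : ℕ} where

    Avoids : (Fin r → Subset m) → List (Vertex r m) → Set
    Avoids U L = ∀ v → v ∈ L → lookup (U (proj₁ v)) (proj₂ v) ≡ false

    removeBlock : (Fin r → Subset m) → Crossing r m → Fin r → Subset m
    removeBlock U g i = U i ─ ⁅ lookup g i ⁆

    unique-vertices : (g : Crossing r m) → Unique (vertices g)
    unique-vertices g = map⁺ (cong proj₁) (allFin⁺ r)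

    place-block : (U : Fin r → Subset m) (g : Crossing r m) (L : List (Vertex r m)) →
      (∀ i → lookup (U i) (lookup g i) ≡ true) → Unique L → Avoids U L →
      Unique (vertices g ++ L) × Avoids (removeBlock U g) (vertices g ++ L)
    place-block U g L g∈U unique avoids = ++⁺ (unique-vertices g) unique disjoint , avoids′
      where
      disjoint : ∀ {v} → ¬ (v ∈ vertices g × v ∈ L)
      disjoint {i , x} (v∈g , v∈L) with refl ← ∈-vertices⁻ g v∈g with () ← trans (sym (g∈U i)) (avoids _ v∈L)
      avoids′ : Avoids (removeBlock U g) (vertices g ++ L)
      avoids′ (i , x) v∈ with ∈-++⁻ (vertices g) v∈
      ... | inj₁ v∈g rewrite ∈-vertices⁻ g v∈g = lookup-─-removed (U i) _ _ (lookup-⁅x⁆-x (lookup g i))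
      ... | inj₂ v∈L = lookup-─-absent (U i) _ x (avoids _ v∈L)

  module PathBuilding {r m : ℕ} (H : RGraph (suc r) m)
    (U₀ : Fin (suc r) → Subset m) (u₀ : ℕ) (∣U₀∣≡u₀ : ∀ i → ∣ U₀ i ∣ ≡ u₀) (t : ℕ)
    (E : Crossing (suc r) m → Bool) (E⊆H : ∀ c → E c ≡ true → H c ≡ true) (E⊆U₀ : ∀ c → E c ≡ true → inAll U₀ c ≡ true)
    (minDegree : Pruning.MinDegree U₀ u₀ ∣U₀∣≡u₀ t E) (rest : List (Vertex (suc r) m)) where

    open Pruning U₀ u₀ ∣U₀∣≡u₀ t using (degree; live⁺)

    Crossing′ : Set
    Crossing′ = Crossing (suc r) m

    freshNeighbour : (U : Fin (suc r) → Subset m) (b : ℕ) → (∀ i x → lookup (U i) x ≡ true → lookup (U₀ i) x ≡ true) →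
      (∀ i → ∣ U i ∣ + b ≡ u₀) → b ≤ t → (f : Crossing′) → E f ≡ true → (j : Fin (suc r)) →
      Σ Crossing′ λ c → E c ≡ true × lookup (U j) (lookup c j) ≡ true × (∀ i → i ≢ j → lookup c i ≡ lookup f i)
    freshNeighbour U b U⊆U₀ ∣U∣+b≡u₀ b≤t f Ef j = c , Ec , cⱼ∈U , agree
      where
      W : Fin (suc r) → Subset m
      W i = U₀ i ─ U i
      ∣W∣≡b : ∣ W j ∣ ≡ b
      ∣W∣≡b = ∣─∣≡ (U₀ j) (U j) b (U⊆U₀ j) (trans (∣U∣+b≡u₀ j) (sym (∣U₀∣≡u₀ j)))
      f∈fibre : inAll (fibre U₀ j f) f ≡ true
      f∈fibre = inAll-fibre-self U₀ j f (inAll⁻ U₀ f (E⊆U₀ f Ef) j)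
      -- the W-fibre has only b ≤ t < degree crossings, so some edge of the U₀-fibre leaves it
      found : Σ Crossing′ λ c → c ∈ allCrossing (suc r) m ×
                (E c ∧ inAll (fibre U₀ j f) c) ≡ true × inAll (fibre W j f) c ≡ false
      found = countᵇ-<⇒∃ (λ c → E c ∧ inAll (fibre U₀ j f) c) (inAll (fibre W j f)) (allCrossing (suc r) m)
        (begin-strict
          countᵇ (inAll (fibre W j f)) (allCrossing (suc r) m) ≡⟨ trans (countᵇ-fibre W j f) ∣W∣≡b ⟩
          b                                                     ≤⟨ b≤t ⟩
          t                                                     <⟨ minDegree j f (E⊆U₀ f Ef) (live⁺ E j f
                                                                     (countᵇ-pos _ _ (∈-allCrossing f) (∧≡true⁺ Ef f∈fibre))) ⟩
          degree E j f                                          ∎)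
        where open ≤-Reasoning
      c : Crossing′
      c = proj₁ found
      c∈E∩fibre : E c ≡ true × inAll (fibre U₀ j f) c ≡ true
      c∈E∩fibre = ∧≡true⁻ (proj₁ (proj₂ (proj₂ found)))
      Ec : E c ≡ true
      Ec = proj₁ c∈E∩fibre
      agree : ∀ i → i ≢ j → lookup c i ≡ lookup f i
      agree = proj₂ (inAll-fibre⁻ U₀ j f c (proj₂ c∈E∩fibre))
      cⱼ∈U : lookup (U j) (lookup c j) ≡ true
      cⱼ∈U with lookup (U j) (lookup c j) in cⱼ∈?U
      ... | true = refl
      ... | false with () ← trans (sym (proj₂ (proj₂ (proj₂ found))))
             (inAll-fibre⁺ W j f c (lookup-─-kept (U₀ j) (U j) _ (proj₁ (inAll-fibre⁻ U₀ j f c (proj₂ c∈E∩fibre))) cⱼ∈?U) agree)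

    record Partial (b : ℕ) : Set where
      field
        U        : Fin (suc r) → Subset m
        head     : Crossing′
        tail     : List (Vertex (suc r) m)
        head∈E   : E head ≡ true
        U⊆U₀     : ∀ i x → lookup (U i) x ≡ true → lookup (U₀ i) x ≡ true
        ∣U∣+b≡u₀ : ∀ i → ∣ U i ∣ + b ≡ u₀
        tight    : TightWalk H (vertices head ++ tail)
        unique   : Unique ((vertices head ++ tail) ++ rest)
        avoids   : Avoids U ((vertices head ++ tail) ++ rest)
        length≡  : length (vertices head ++ tail) ≡ suc r * b

    module Extend {b : ℕ} (P : Partial b) (b≤t : b ≤ t) where
      open Partial P

      -- new blocks are prepended to the path, so coordinates are replaced from the top down
      record Sweep (k : ℕ) (f : Crossing′) : Set where
        field
          f∈E    : E f ≡ true
          below  : ∀ i → toℕ i < k → lookup f i ≡ lookup head i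
          above  : ∀ i → k ≤ toℕ i → lookup (U i) (lookup f i) ≡ true
          linked : ∀ s → k ≤ s → s < suc r → Σ Crossing′ λ e → H e ≡ true ×
                     (∀ i → s ≤ toℕ i → lookup e i ≡ lookup f i) × (∀ i → toℕ i < s → lookup e i ≡ lookup head i)

      sweepStart : Sweep (suc r) head
      sweepStart = record
        { f∈E = head∈E ; below = λ _ _ → refl
        ; above = λ i r<i → contradiction (Fin.toℕ<n i) (≤⇒≯ r<i)
        ; linked = λ s r<s s<r → contradiction s<r (≤⇒≯ r<s) }

      sweepStep : (k : ℕ) (k<r : k < suc r) (f : Crossing′) → Sweep (suc k) f → Σ Crossing′ (Sweep k)
      sweepStep k k<r f sw = f' , record { f∈E = f'∈E ; below = below′ ; above = above′ ; linked = linked′ }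
        where
        open Sweep sw
        j : Fin (suc r)
        j = F.fromℕ< k<r
        toℕj≡k : toℕ j ≡ k
        toℕj≡k = Fin.toℕ-fromℕ< k<r
        neighbour : Σ Crossing′ λ c → E c ≡ true × lookup (U j) (lookup c j) ≡ true × (∀ i → i ≢ j → lookup c i ≡ lookup f i)
        neighbour = freshNeighbour U b U⊆U₀ ∣U∣+b≡u₀ b≤t f f∈E j
        f' : Crossing′
        f' = proj₁ neighbour
        f'∈E : E f' ≡ true
        f'∈E = proj₁ (proj₂ neighbour)
        off-j : ∀ i → toℕ i ≢ k → lookup f' i ≡ lookup f i
        off-j i i≢k = proj₂ (proj₂ (proj₂ neighbour)) i λ i≡j → i≢k (trans (cong toℕ i≡j) toℕj≡k)
        below′ : ∀ i → toℕ i < k → lookup f' i ≡ lookup head i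
        below′ i i<k = trans (off-j i (<⇒≢ i<k)) (below i (m≤n⇒m≤1+n i<k))
        above′ : ∀ i → k ≤ toℕ i → lookup (U i) (lookup f' i) ≡ true
        above′ i k≤i with toℕ i ≟ k
        ... | yes i≡k rewrite Fin.toℕ-injective (trans i≡k (sym toℕj≡k)) = proj₁ (proj₂ (proj₂ neighbour))
        ... | no i≢k rewrite off-j i i≢k = above i (≤∧≢⇒< k≤i (i≢k ∘ sym))
        linked′ : ∀ s → k ≤ s → s < suc r → Σ Crossing′ λ e → H e ≡ true ×
                    (∀ i → s ≤ toℕ i → lookup e i ≡ lookup f' i) × (∀ i → toℕ i < s → lookup e i ≡ lookup head i)
        linked′ s k≤s s<r with s ≟ k
        ... | yes refl = f' , E⊆H f' f'∈E , (λ _ _ → refl) , below′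
        ... | no s≢k with linked s (≤∧≢⇒< k≤s (s≢k ∘ sym)) s<r
        ...   | e , He , e-above , e-below =
                e , He , (λ i s≤i → trans (e-above i s≤i) (sym (off-j i λ i≡k → s≢k (≤-antisym (subst (s ≤_) i≡k s≤i) k≤s)))) , e-below

      sweep : (d k : ℕ) → d + k ≡ suc r → Σ Crossing′ (Sweep k)
      sweep zero k refl = head , sweepStart
      sweep (suc d) k d+k≡r = uncurry (sweepStep k k<r) (sweep d (suc k) (trans (+-suc d k) d+k≡r))
        where
        k<r : k < suc r
        k<r = subst (k <_) d+k≡r (m<n+m k (s≤s z≤n))

      extend : Partial (suc b)
      extend = record
        { U        = removeBlock U g'
        ; head     = g'
        ; tail     = vertices head ++ tail
        ; head∈E   = f∈E
        ; U⊆U₀     = λ i x h → U⊆U₀ i x (lookup-─⇒ (U i) _ x h)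
        ; ∣U∣+b≡u₀ = λ i → trans (+-suc _ b) (trans (cong (_+ b) (suc∣─⁅x⁆∣≡∣∣ (U i) _ (above i z≤n))) (∣U∣+b≡u₀ i))
        ; tight    = tight-∷ H g' head tail tight (λ s s<r → linked s z≤n s<r)
        ; unique   = subst Unique (sym (++-assoc (vertices g') _ rest)) (proj₁ placed)
        ; avoids   = subst (Avoids (removeBlock U g')) (sym (++-assoc (vertices g') _ rest)) (proj₂ placed)
        ; length≡  = trans (length-++ (vertices g')) (trans (cong₂ _+_ (length-vertices g') length≡) (sym (*-suc (suc r) b)))
        }
        where
        swept : Σ Crossing′ (Sweep 0)
        swept = sweep (suc r) 0 (+-identityʳ (suc r))
        g' : Crossing′
        g' = proj₁ swept
        open Sweep (proj₂ swept)
        placed : Unique (vertices g' ++ (vertices head ++ tail) ++ rest) × Avoids (removeBlock U g') (vertices g' ++ (vertices head ++ tail) ++ rest)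
        placed = place-block U g' ((vertices head ++ tail) ++ rest) (λ i → above i z≤n) unique avoids

    start : (g : Crossing′) → E g ≡ true → Unique rest → Avoids U₀ rest → Partial 1
    start g Eg unique avoids = record
      { U        = removeBlock U₀ g
      ; head     = g
      ; tail     = []
      ; head∈E   = Eg
      ; U⊆U₀     = λ i x h → lookup-─⇒ (U₀ i) _ x h
      ; ∣U∣+b≡u₀ = λ i → trans (+-comm _ 1) (trans (suc∣─⁅x⁆∣≡∣∣ (U₀ i) _ (g∈U₀ i)) (∣U₀∣≡u₀ i))
      ; tight    = subst (TightWalk H) (sym (++-identityʳ (vertices g))) (tight-single H g (E⊆H g Eg))
      ; unique   = subst (λ P → Unique (P ++ rest)) (sym (++-identityʳ (vertices g))) (proj₁ placed)
      ; avoids   = subst (λ P → Avoids (removeBlock U₀ g) (P ++ rest)) (sym (++-identityʳ (vertices g))) (proj₂ placed)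
      ; length≡  = trans (cong length (++-identityʳ (vertices g))) (trans (length-vertices g) (sym (*-identityʳ (suc r))))
      }
      where
      g∈U₀ : ∀ i → lookup (U₀ i) (lookup g i) ≡ true
      g∈U₀ = inAll⁻ U₀ g (E⊆U₀ g Eg)
      placed : Unique (vertices g ++ rest) × Avoids (removeBlock U₀ g) (vertices g ++ rest)
      placed = place-block U₀ g rest g∈U₀ unique avoids

    grow : (n b : ℕ) → Partial b → n + b ≡ suc t → Partial (suc t)
    grow zero b P refl = P
    grow (suc n) b P n+b≡t = grow n (suc b) (Extend.extend P b≤t) (trans (+-suc n b) n+b≡t)
      where
      b≤t : b ≤ t
      b≤t = subst (b ≤_) (suc-injective n+b≡t) (m≤n+m b n)

  bracket : (X Y : ℕ) → 0 < X → 0 < Y → Σ ℕ λ t → t * X < Y × Y ≤ suc t * X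
  bracket X@(suc _) Y@(suc Y-1) 0<X 0<Y = Y-1 / X , s≤s (m/n*n≤m Y-1 X) , (begin
    suc Y-1                         ≡⟨ cong suc (m≡m%n+[m/n]*n Y-1 X) ⟩
    suc (Y-1 % X + Y-1 / X * X)     ≤⟨ +-monoˡ-≤ (Y-1 / X * X) (m%n<n Y-1 X) ⟩
    X + Y-1 / X * X                 ∎)
    where open ≤-Reasoning

  module _ {r m : ℕ} (H : RGraph (suc r) m) (U : Fin (suc r) → Subset m) (u : ℕ) (∣U∣≡u : ∀ i → ∣ U i ∣ ≡ u)
           (rest : List (Vertex (suc r) m)) (unique : Unique rest) (avoids : Avoids U rest) where

    record NewPath : Set where
      field
        t        : ℕ
        U'       : Fin (suc r) → Subset m
        path     : List (Vertex (suc r) m)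
        ∣U'∣+t≡u : ∀ i → ∣ U' i ∣ + suc t ≡ u
        non-empty : NonEmpty path
        tight    : TightWalk H path
        unique'  : Unique (path ++ rest)
        avoids'  : Avoids U' (path ++ rest)
        length≡  : length path ≡ suc r * suc t
        enough   : u * edgesBetween H U ≤ suc t * (suc r * u ^ suc r)

    newPath : 0 < u → 0 < edgesBetween H U → NewPath
    newPath 0<u 0<e = record
      { t = t ; U' = U' ; path = vertices head ++ tail ; ∣U'∣+t≡u = ∣U∣+b≡u₀
      ; non-empty = nonEmpty ; tight = tight ; unique' = unique′ ; avoids' = avoids′ ; length≡ = length≡
      ; enough = ue≤[t+1]X }
      where
      e X : ℕ
      e = edgesBetween H U
      X = suc r * u ^ suc r
      0<X : 0 < X
      0<X = *-mono-< {0} {suc r} (s≤s z≤n) (m^n>0 u {{ℕ.>-nonZero 0<u}} (suc r))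
      bracketed : Σ ℕ λ t → t * X < u * e × u * e ≤ suc t * X
      bracketed = bracket X (u * e) 0<X (*-mono-< 0<u 0<e)
      t : ℕ
      t = proj₁ bracketed
      ue≤[t+1]X : u * e ≤ suc t * X
      ue≤[t+1]X = proj₂ (proj₂ bracketed)
      open Pruning U u ∣U∣≡u t
      E₀ : EdgeSet
      E₀ c = H c ∧ inAll U c
      dense₀ : Dense E₀
      dense₀ = ≤-<-trans (*-monoʳ-≤ t (liveTotal≤ E₀)) (proj₁ (proj₂ bracketed))
      pruned : Σ EdgeSet λ E → E ⊆ₑ E₀ × Dense E × MinDegree E
      pruned = prune (size E₀) E₀ ≤-refl dense₀
      E : EdgeSet
      E = proj₁ pruned
      E⊆E₀ : E ⊆ₑ E₀
      E⊆E₀ = proj₁ (proj₂ pruned)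
      E≠∅ : Σ (Crossing (suc r) m) λ g → g ∈ allCrossing (suc r) m × E g ≡ true
      E≠∅ = countᵇ>0⇒∃ E (allCrossing (suc r) m) (dense⇒size>0 E (proj₁ (proj₂ (proj₂ pruned))))
      open PathBuilding H U u ∣U∣≡u t E (λ c h → ∧≡true⁻ {H c} (E⊆E₀ c h) .proj₁)
                                         (λ c h → ∧≡true⁻ {H c} (E⊆E₀ c h) .proj₂)
                        (proj₂ (proj₂ (proj₂ pruned))) rest
      open Partial (grow t 1 (start (proj₁ E≠∅) (proj₂ (proj₂ E≠∅)) unique avoids) (+-comm t 1))
        renaming (U to U'; unique to unique′; avoids to avoids′)

module Rationals where

  open import Data.Nat as ℕ using (ℕ; zero; suc)
  import Data.Nat.Properties as ℕ
  open import Data.Integer as ℤ using (+_)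
  import Data.Integer.Properties as ℤ
  open import Data.Rational using (ℚ; 0ℚ; _≤_; _+_; _*_; _-_; -_; ∣_∣; toℚᵘ; NonNegative; Positive)
  open import Data.Rational.Properties
  open import Data.Rational.Unnormalised as ℚᵘ using (mkℚᵘ; *≡*) renaming (_≃_ to _≃ᵘ_)
  import Data.Rational.Unnormalised.Properties as ℚᵘ
  open import Data.Rational.Solver using (module +-*-Solver)
  open import Data.Sum using (inj₁; inj₂)
  open import Relation.Binary.PropositionalEquality

  toℚᵘ-fromℕℚ : (n : ℕ) → toℚᵘ (fromℕℚ n) ≃ᵘ mkℚᵘ (+ n) 0
  toℚᵘ-fromℕℚ n = toℚᵘ-fromℚᵘ (mkℚᵘ (+ n) 0)

  fromℕℚ-homo-+ : (a b : ℕ) → fromℕℚ (a ℕ.+ b) ≡ fromℕℚ a + fromℕℚ b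
  fromℕℚ-homo-+ a b = toℚᵘ-injective (begin
    toℚᵘ (fromℕℚ (a ℕ.+ b))               ≈⟨ toℚᵘ-fromℕℚ (a ℕ.+ b) ⟩
    mkℚᵘ (+ (a ℕ.+ b)) 0                  ≈⟨ *≡* (cong (ℤ._* + 1) (trans (ℤ.pos-+ a b)
                                                (sym (cong₂ ℤ._+_ (ℤ.*-identityʳ (+ a)) (ℤ.*-identityʳ (+ b)))))) ⟩
    mkℚᵘ (+ a) 0 ℚᵘ.+ mkℚᵘ (+ b) 0        ≈⟨ ℚᵘ.+-cong (toℚᵘ-fromℕℚ a) (toℚᵘ-fromℕℚ b) ⟨
    toℚᵘ (fromℕℚ a) ℚᵘ.+ toℚᵘ (fromℕℚ b)  ≈⟨ toℚᵘ-homo-+ (fromℕℚ a) (fromℕℚ b) ⟨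
    toℚᵘ (fromℕℚ a + fromℕℚ b)            ∎)
    where open ℚᵘ.≃-Reasoning

  fromℕℚ-homo-* : (a b : ℕ) → fromℕℚ (a ℕ.* b) ≡ fromℕℚ a * fromℕℚ b
  fromℕℚ-homo-* a b = toℚᵘ-injective (begin
    toℚᵘ (fromℕℚ (a ℕ.* b))               ≈⟨ toℚᵘ-fromℕℚ (a ℕ.* b) ⟩
    mkℚᵘ (+ (a ℕ.* b)) 0                  ≈⟨ *≡* (cong (ℤ._* + 1) (ℤ.pos-* a b)) ⟩
    mkℚᵘ (+ a) 0 ℚᵘ.* mkℚᵘ (+ b) 0        ≈⟨ ℚᵘ.*-cong (toℚᵘ-fromℕℚ a) (toℚᵘ-fromℕℚ b) ⟨
    toℚᵘ (fromℕℚ a) ℚᵘ.* toℚᵘ (fromℕℚ b)  ≈⟨ toℚᵘ-homo-* (fromℕℚ a) (fromℕℚ b) ⟨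
    toℚᵘ (fromℕℚ a * fromℕℚ b)            ∎)
    where open ℚᵘ.≃-Reasoning

  fromℕℚ-nonNeg : (n : ℕ) → NonNegative (fromℕℚ n)
  fromℕℚ-nonNeg n = normalize-nonNeg n 1

  fromℕℚ-pos : (n : ℕ) → Positive (fromℕℚ (suc n))
  fromℕℚ-pos n = normalize-pos (suc n) 1

  fromℕℚ-mono-≤ : {a b : ℕ} → a ℕ.≤ b → fromℕℚ a ≤ fromℕℚ b
  fromℕℚ-mono-≤ {a} {b} a≤b = begin
    fromℕℚ a                        ≡⟨ +-identityʳ (fromℕℚ a) ⟨
    fromℕℚ a + 0ℚ                   ≤⟨ +-monoʳ-≤ (fromℕℚ a) (nonNegative⁻¹ _ {{fromℕℚ-nonNeg (b ℕ.∸ a)}}) ⟩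
    fromℕℚ a + fromℕℚ (b ℕ.∸ a)     ≡⟨ fromℕℚ-homo-+ a (b ℕ.∸ a) ⟨
    fromℕℚ (a ℕ.+ (b ℕ.∸ a))        ≡⟨ cong fromℕℚ (ℕ.m+[n∸m]≡n a≤b) ⟩
    fromℕℚ b                        ∎
    where open ≤-Reasoning

  ratio-*-denominator : (e n : ℕ) → ratio e (suc n) * fromℕℚ (suc n) ≡ fromℕℚ e
  ratio-*-denominator e n = toℚᵘ-injective (begin
    toℚᵘ (ratio e (suc n) * fromℕℚ (suc n))           ≈⟨ toℚᵘ-homo-* (ratio e (suc n)) (fromℕℚ (suc n)) ⟩
    toℚᵘ (ratio e (suc n)) ℚᵘ.* toℚᵘ (fromℕℚ (suc n)) ≈⟨ ℚᵘ.*-cong (toℚᵘ-fromℚᵘ (mkℚᵘ (+ e) n)) (toℚᵘ-fromℕℚ (suc n)) ⟩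
    mkℚᵘ (+ e) n ℚᵘ.* mkℚᵘ (+ suc n) 0                ≈⟨ *≡* (trans (ℤ.*-identityʳ _) (trans (sym (ℤ.pos-* e (suc n)))
                                                            (trans (cong (λ k → + (e ℕ.* suc k)) (sym (ℕ.*-identityʳ n))) (ℤ.pos-* e (suc (n ℕ.* 1)))))) ⟩
    mkℚᵘ (+ e) 0                                      ≈⟨ toℚᵘ-fromℕℚ e ⟨
    toℚᵘ (fromℕℚ e)                                   ∎)
    where open ℚᵘ.≃-Reasoning

  -p≤∣p∣ : (p : ℚ) → - p ≤ ∣ p ∣
  -p≤∣p∣ p with ∣p∣≡p∨∣p∣≡-p p
  ... | inj₂ ∣p∣≡-p = ≤-reflexive (sym ∣p∣≡-p)
  ... | inj₁ ∣p∣≡p = ≤-trans (neg-antimono-≤ (∣p∣≡p⇒0≤p ∣p∣≡p)) (0≤∣p∣ p)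

  ∣p-q∣≤r⇒q-r≤p : (p q r : ℚ) → ∣ p - q ∣ ≤ r → q - r ≤ p
  ∣p-q∣≤r⇒q-r≤p p q r h = subst₂ _≤_ (solve 3 (λ p q r → (:- (p :- q)) :+ (p :- r) := q :- r) refl p q r)
                                    (solve 2 (λ p r → r :+ (p :- r) := p) refl p r)
                                    (+-monoˡ-≤ (p - r) (≤-trans (-p≤∣p∣ (p - q)) h))
    where open +-*-Solver

  ratio-zero : (p : ℕ) → ratio 0 p ≡ 0ℚ
  ratio-zero zero = refl
  ratio-zero (suc p) = 0/n≡0 (suc p)


module Covering {r m : ℕ} (ε : ℚ) (H : RGraph (suc r) (suc m))
                (0<ε : 0ℚ ℚ.< ε) (ε<d : ε ℚ.< density H full) (regular : IsRegular ε H) where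

  open TightPaths using (Avoids; NewPath; newPath; prodSizes-const)
  open Rationals
  open import Data.Nat as ℕ using (ℕ; zero; suc)
  import Data.Nat.Properties as ℕ
  open import Data.Rational using (ℚ; 0ℚ; _≤_; _<_; _+_; _*_; _-_; -_; nonNegative)
  open import Data.Rational.Properties
  open import Data.Rational.Solver using (module +-*-Solver)
  open import Data.Nat.Solver using () renaming (module +-*-Solver to ℕ-Solver)
  open import Data.Fin as Fin using (Fin)
  open import Data.Fin.Subset as Sub using (Subset)
  open import Data.Fin.Subset.Properties using (∣⊤∣≡n)
  open import Data.List using (List; []; _∷_; length; concat)
  open import Data.List.Properties using (length-++)
  open import Data.List.Relation.Unary.All using (All; []; _∷_)
  open import Data.List.Relation.Unary.AllPairs using ([])
  open import Data.List.Relation.Unary.Unique.Propositional using (Unique)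
  open import Data.Product using (_×_; _,_; Σ; proj₁; proj₂)
  open import Relation.Binary.PropositionalEquality
  open import Relation.Nullary using (yes; no; contradiction)

  R M : ℕ
  R = suc r
  M = suc m

  δ : ℚ
  δ = density H full - ε

  weight : ℚ
  weight = δ * ε * fromℕℚ M

  0<δ : 0ℚ < δ
  0<δ = subst (_< δ) (+-inverseʳ ε) (+-monoˡ-< (- ε) ε<d)

  0<εM : 0ℚ < ε * fromℕℚ M
  0<εM = subst (_< ε * fromℕℚ M) (*-zeroˡ (fromℕℚ M)) (*-monoˡ-<-pos (fromℕℚ M) {{fromℕℚ-pos m}} 0<ε)

  path-weight : (u e p t : ℕ) → ε * fromℕℚ M ≤ fromℕℚ u → δ ≤ ratio e p →
    u ℕ.* e ℕ.≤ suc t ℕ.* (R ℕ.* p) → weight ≤ fromℕℚ (R ℕ.* suc t)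
  path-weight u e zero t _ δ≤0 _ = contradiction (<-≤-trans 0<δ δ≤0) (<-irrefl refl)
  path-weight u e (suc n) t εM≤u δ≤ρ ue≤ = begin
    δ * ε * fromℕℚ M          ≡⟨ *-assoc δ ε (fromℕℚ M) ⟩
    δ * (ε * fromℕℚ M)        ≤⟨ *-monoˡ-≤-nonNeg δ {{nonNegative (<⇒≤ 0<δ)}} εM≤u ⟩
    δ * fromℕℚ u              ≤⟨ *-monoʳ-≤-nonNeg (fromℕℚ u) {{fromℕℚ-nonNeg u}} δ≤ρ ⟩
    ρ * fromℕℚ u              ≤⟨ *-cancelʳ-≤-pos P {{fromℕℚ-pos n}} (begin
      ρ * fromℕℚ u * P               ≡⟨ solve 3 (λ a b c → a :* b :* c := b :* (a :* c)) refl ρ (fromℕℚ u) P ⟩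
      fromℕℚ u * (ρ * P)             ≡⟨ cong (fromℕℚ u *_) (ratio-*-denominator e n) ⟩
      fromℕℚ u * fromℕℚ e            ≡⟨ fromℕℚ-homo-* u e ⟨
      fromℕℚ (u ℕ.* e)               ≤⟨ fromℕℚ-mono-≤ ue≤ ⟩
      fromℕℚ (suc t ℕ.* (R ℕ.* suc n)) ≡⟨ cong fromℕℚ (trans (sym (ℕ.*-assoc (suc t) R (suc n))) (cong (ℕ._* suc n) (ℕ.*-comm (suc t) R))) ⟩
      fromℕℚ (R ℕ.* suc t ℕ.* suc n) ≡⟨ fromℕℚ-homo-* (R ℕ.* suc t) (suc n) ⟩
      fromℕℚ (R ℕ.* suc t) * P       ∎) ⟩
    fromℕℚ (R ℕ.* suc t)      ∎
    where
    open ≤-Reasoning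
    open +-*-Solver
    ρ = ratio e (suc n)
    P = fromℕℚ (suc n)

  record Cover : Set where
    field
      U        : Fin R → Subset M
      u        : ℕ
      used     : ℕ
      ∣U∣≡u    : ∀ i → Sub.∣ U i ∣ ≡ u
      paths    : List (List (Vertex R M))
      tight    : All (IsTightPathIn H) paths
      unique   : Unique (concat paths)
      avoids   : Avoids U (concat paths)
      covered  : length (concat paths) ≡ R ℕ.* used
      used+u   : used ℕ.+ u ≡ M
      weighted : fromℕℚ (length paths) * weight ≤ fromℕℚ (R ℕ.* used)

  empty : Cover
  empty = record
    { U = full ; u = M ; used = 0 ; ∣U∣≡u = λ _ → ∣⊤∣≡n M ; paths = [] ; tight = [] ; unique = []
    ; avoids = λ _ () ; covered = sym (ℕ.*-zeroʳ R) ; used+u = refl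
    ; weighted = subst (_≤ fromℕℚ (R ℕ.* 0)) (sym (*-zeroˡ weight)) (nonNegative⁻¹ _ {{fromℕℚ-nonNeg (R ℕ.* 0)}}) }

  box-density : (U : Fin R → Subset M) (u : ℕ) → (∀ i → Sub.∣ U i ∣ ≡ u) → ε * fromℕℚ M ≤ fromℕℚ u →
    δ ≤ density H U
  box-density U u ∣U∣≡u εM≤u = ∣p-q∣≤r⇒q-r≤p (density H U) (density H full) ε
    (regular U λ i → subst (λ z → ε * fromℕℚ M ≤ fromℕℚ z) (sym (∣U∣≡u i)) εM≤u)

  εM≤u⇒0<u : (u : ℕ) → ε * fromℕℚ M ≤ fromℕℚ u → 0 ℕ.< u
  εM≤u⇒0<u u εM≤u = ℕ.n≢0⇒n>0 λ u≡0 →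
    <-irrefl refl (<-≤-trans 0<εM (subst (λ z → ε * fromℕℚ M ≤ fromℕℚ z) u≡0 εM≤u))

  δ≤density⇒0<e : (U : Fin R → Subset M) → δ ≤ density H U → 0 ℕ.< edgesBetween H U
  δ≤density⇒0<e U δ≤density = ℕ.n≢0⇒n>0 λ e≡0 → <-irrefl refl (<-≤-trans 0<δ
    (subst (δ ≤_) (trans (cong (λ e → ratio e (prodSizes U)) e≡0) (ratio-zero (prodSizes U))) δ≤density))

  weighted-∷ : (n k used : ℕ) → weight ≤ fromℕℚ (R ℕ.* k) → fromℕℚ n * weight ≤ fromℕℚ (R ℕ.* used) →
    fromℕℚ (suc n) * weight ≤ fromℕℚ (R ℕ.* (k ℕ.+ used))
  weighted-∷ n k used weight≤ weighted = begin
    fromℕℚ (suc n) * weight                   ≡⟨ cong (_* weight) (fromℕℚ-homo-+ 1 n) ⟩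
    (fromℕℚ 1 + fromℕℚ n) * weight            ≡⟨ *-distribʳ-+ weight (fromℕℚ 1) (fromℕℚ n) ⟩
    fromℕℚ 1 * weight + fromℕℚ n * weight     ≡⟨ cong (_+ fromℕℚ n * weight) (*-identityˡ weight) ⟩
    weight + fromℕℚ n * weight                ≤⟨ +-mono-≤ weight≤ weighted ⟩
    fromℕℚ (R ℕ.* k) + fromℕℚ (R ℕ.* used)    ≡⟨ fromℕℚ-homo-+ (R ℕ.* k) (R ℕ.* used) ⟨
    fromℕℚ (R ℕ.* k ℕ.+ R ℕ.* used)           ≡⟨ cong fromℕℚ (ℕ.*-distribˡ-+ R k used) ⟨
    fromℕℚ (R ℕ.* (k ℕ.+ used))               ∎
    where open ≤-Reasoning

  addPath : (C : Cover) → ε * fromℕℚ M ≤ fromℕℚ (Cover.u C) → Σ Cover λ C' → Cover.u C' ℕ.< Cover.u C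
  addPath C εM≤u = C' , ℕ.m+n≤o⇒m≤o (suc u') {t} (ℕ.≤-reflexive (trans (sym (ℕ.+-suc u' t)) (∣U'∣+t≡u Fin.zero)))
    where
    open Cover C
    δ≤density : δ ≤ density H U
    δ≤density = box-density U u ∣U∣≡u εM≤u
    open NewPath (newPath H U u ∣U∣≡u (concat paths) unique avoids (εM≤u⇒0<u u εM≤u) (δ≤density⇒0<e U δ≤density))
      renaming (tight to path-tight)
    u' : ℕ
    u' = Sub.∣ U' Fin.zero ∣
    weight≤ : weight ≤ fromℕℚ (R ℕ.* suc t)
    weight≤ = path-weight u (edgesBetween H U) (prodSizes U) t εM≤u δ≤density
                (subst (λ p → u ℕ.* edgesBetween H U ℕ.≤ suc t ℕ.* (R ℕ.* p)) (sym (prodSizes-const U u ∣U∣≡u)) enough)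
    C' : Cover
    C' = record
      { U = U' ; u = u' ; used = suc t ℕ.+ used
      ; ∣U∣≡u = λ i → ℕ.+-cancelʳ-≡ (suc t) _ _ (trans (∣U'∣+t≡u i) (sym (∣U'∣+t≡u Fin.zero)))
      ; paths = path ∷ paths ; tight = (non-empty , path-tight) ∷ tight
      ; unique = unique' ; avoids = avoids'
      ; covered = trans (length-++ path) (trans (cong₂ ℕ._+_ length≡ covered) (sym (ℕ.*-distribˡ-+ R (suc t) used)))
      ; used+u = trans rearrange (trans (cong (used ℕ.+_) (∣U'∣+t≡u Fin.zero)) used+u)
      ; weighted = weighted-∷ (length paths) (suc t) used weight≤ weighted
      }
      where
      rearrange : suc t ℕ.+ used ℕ.+ u' ≡ used ℕ.+ (u' ℕ.+ suc t)
      rearrange = solve 3 (λ k a b → k :+ a :+ b := a :+ (b :+ k)) refl (suc t) used u'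
        where open ℕ-Solver

  Goal : Set
  Goal = Σ (List (List (Vertex R M))) λ ps →
    All (IsTightPathIn H) ps × Unique (concat ps) ×
    (fromℕℚ (length ps) * (δ * ε) ≤ fromℕℚ (3 ℕ.* R)) ×
    (fromℕℚ (R ℕ.* M ℕ.∸ length (concat ps)) ≤ fromℕℚ R * ε * fromℕℚ M)

  finish : (C : Cover) → fromℕℚ (Cover.u C) < ε * fromℕℚ M → Goal
  finish C u<εM = paths , tight , unique , few-paths , few-uncovered
    where
    open Cover C
    few-paths : fromℕℚ (length paths) * (δ * ε) ≤ fromℕℚ (3 ℕ.* R)
    few-paths = *-cancelʳ-≤-pos (fromℕℚ M) {{fromℕℚ-pos m}} (begin
      fromℕℚ (length paths) * (δ * ε) * fromℕℚ M ≡⟨ *-assoc (fromℕℚ (length paths)) (δ * ε) (fromℕℚ M) ⟩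
      fromℕℚ (length paths) * weight             ≤⟨ weighted ⟩
      fromℕℚ (R ℕ.* used)                        ≤⟨ fromℕℚ-mono-≤ (ℕ.*-mono-≤ (ℕ.m≤n*m R 3) (subst (used ℕ.≤_) used+u (ℕ.m≤m+n used u))) ⟩
      fromℕℚ (3 ℕ.* R ℕ.* M)                     ≡⟨ fromℕℚ-homo-* (3 ℕ.* R) M ⟩
      fromℕℚ (3 ℕ.* R) * fromℕℚ M                ∎)
      where open ≤-Reasoning
    uncovered : R ℕ.* M ℕ.∸ length (concat paths) ≡ R ℕ.* u
    uncovered = begin
      R ℕ.* M ℕ.∸ length (concat paths)       ≡⟨ cong₂ ℕ._∸_ (cong (R ℕ.*_) (sym used+u)) covered ⟩
      R ℕ.* (used ℕ.+ u) ℕ.∸ R ℕ.* used       ≡⟨ cong (ℕ._∸ R ℕ.* used) (ℕ.*-distribˡ-+ R used u) ⟩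
      R ℕ.* used ℕ.+ R ℕ.* u ℕ.∸ R ℕ.* used   ≡⟨ ℕ.m+n∸m≡n (R ℕ.* used) (R ℕ.* u) ⟩
      R ℕ.* u                                 ∎
      where open ≡-Reasoning
    few-uncovered : fromℕℚ (R ℕ.* M ℕ.∸ length (concat paths)) ≤ fromℕℚ R * ε * fromℕℚ M
    few-uncovered = begin
      fromℕℚ (R ℕ.* M ℕ.∸ length (concat paths)) ≡⟨ cong fromℕℚ uncovered ⟩
      fromℕℚ (R ℕ.* u)                          ≡⟨ fromℕℚ-homo-* R u ⟩
      fromℕℚ R * fromℕℚ u                       ≤⟨ *-monoˡ-≤-nonNeg (fromℕℚ R) {{fromℕℚ-nonNeg R}} (<⇒≤ u<εM) ⟩
      fromℕℚ R * (ε * fromℕℚ M)                 ≡⟨ *-assoc (fromℕℚ R) ε (fromℕℚ M) ⟨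
      fromℕℚ R * ε * fromℕℚ M                   ∎
      where open ≤-Reasoning

  cover : (n : ℕ) (C : Cover) → Cover.u C ℕ.≤ n → Goal
  cover n C u≤n with ε * fromℕℚ M ≤? fromℕℚ (Cover.u C)
  ... | no εM≰u = finish C (≰⇒> εM≰u)
  cover zero C u≤0 | yes εM≤u = contradiction (ℕ.<-≤-trans (proj₂ (addPath C εM≤u)) u≤0) ℕ.n≮0
  cover (suc n) C u≤n | yes εM≤u = cover n (proj₁ (addPath C εM≤u)) (ℕ.s≤s⁻¹ (ℕ.<-≤-trans (proj₂ (addPath C εM≤u)) u≤n))


open import Data.Nat using (ℕ; _*_; _∸_; zero; suc)
import Data.Nat.Properties as ℕ
open import Data.List using (List; length; concat; [])
open import Data.List.Relation.Unary.All using (All; [])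
open import Data.List.Relation.Unary.AllPairs using ([])
open import Data.List.Relation.Unary.Unique.Propositional using (Unique)
open import Data.Product using (Σ; _×_; _,_)
open import Data.Rational using (ℚ; 0ℚ; _<_; _≤_; _-_)
open import Data.Rational.Properties using (*-zeroˡ; *-zeroʳ; ≤-refl; ≤-reflexive; nonNegative⁻¹)
open import Relation.Binary.PropositionalEquality

lemma3p3 : (r m : ℕ) (ε : ℚ) (H : RGraph r m) →
    0ℚ < ε → ε < density H full →
    IsRegular ε H →
    Σ (List (List (Vertex r m))) λ ps →
      All (IsTightPathIn H) ps × Unique (concat ps) ×
      (fromℕℚ (length ps) Data.Rational.* ((density H full - ε) Data.Rational.* ε) ≤ fromℕℚ (3 * r)) ×
      (fromℕℚ (r * m ∸ length (concat ps)) ≤ fromℕℚ r Data.Rational.* ε Data.Rational.* fromℕℚ m)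
lemma3p3 zero m ε H 0<ε ε<d regular = [] , [] , [] ,
  ≤-reflexive (*-zeroˡ ((density H full - ε) Data.Rational.* ε)) ,
  ≤-reflexive (sym (trans (cong (Data.Rational._* fromℕℚ m) (*-zeroˡ ε)) (*-zeroˡ (fromℕℚ m))))
lemma3p3 (suc r) zero ε H 0<ε ε<d regular = [] , [] , [] ,
  subst (_≤ fromℕℚ (3 * suc r)) (sym (*-zeroˡ ((density H full - ε) Data.Rational.* ε)))
        (nonNegative⁻¹ _ {{Rationals.fromℕℚ-nonNeg (3 * suc r)}}) ,
  subst₂ _≤_ (cong fromℕℚ (sym (ℕ.*-zeroʳ (suc r)))) (sym (*-zeroʳ (fromℕℚ (suc r) Data.Rational.* ε))) ≤-refl
lemma3p3 (suc r) (suc m) ε H 0<ε ε<d regular = cover (suc m) empty ℕ.≤-refl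
  where open Covering ε H 0<ε ε<d regular
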